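{- There exists a class of finite structures definable by a monadic linear Boolean Datalog program that is not decided by any adaptive left unbounded query algorithm over $\mathbb{B}$.
   Context: Structures are finite relational structures with non-empty domain over a finite signature $\tau$; $\mathsf{FIN}(\tau)$ is the class of all of them. A Boolean Datalog program is a finite set of rules $H\leftarrow B_1,\dots,B_m$ whose heads are atoms over intensional (recursive) predicates not in $\tau$, whose bodies are atoms over $\tau$ and the intensional predicates (and possibly equalities), with a distinguished $0$-ary goal predicate; it defines the class of structures on which the goal predicate is derived in the least fixpoint semantics. It is monadic if all intensional predicates other than the goal are unary, and linear if every rule body contains at most one occurrence of an intensional predicate. $\hom_{\mathbb{B}}(F,D)$ is $1$ if there is a homomorphism $F\to D$ and $0$ otherwise. For a set $\Sigma$, $\Sigma^{<\omega}$ is the set of finite strings over $\Sigma$; a subtree is a prefix-closed subset, a leaf an element with no proper extension. An adaptive left unbounded query algorithm over $\mathbb{B}$ is a function $G:\mathcal{T}\to\mathsf{FIN}(\tau)\cup\{\mathsf{YES},\mathsf{NO}\}$ with $\mathcal{T}\subseteq\{0,1\}^{<\omega}$ a subtree and $G(\sigma)\in\{\mathsf{YES},\mathsf{NO}\}$ iff $\sigma$ is a leaf; its computation path on $D$ is the limit of $\sigma_0=\varepsilon$, $\sigma_{i+1}=\sigma_i$ if $G(\sigma_i)\in\{\mathsf{YES},\mathsf{NO}\}$, else $\sigma_{i+1}=\sigma_i\bullet\hom_{\mathbb{B}}(G(\sigma_i),D)$; it must be total (finite path on every input) and decides $\{D:G(\text{path of }D)=\mathsf{YES}\}$. -}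

module Defs where

open import Data.Nat using (ℕ; zero; suc; _≤_)
open import Data.Fin using (Fin)
open import Data.Bool using (Bool; true; false)
open import Data.Vec using (Vec; map)
open import Data.List using (List; []; _∷_; _∷ʳ_)
open import Data.List.Membership.Propositional using (_∈_)
open import Data.Product using (Σ; _×_; ∃)
open import Data.Sum using (_⊎_)
open import Relation.Binary.PropositionalEquality using (_≡_; _≢_)
open import Relation.Nullary using (¬_)

record Signature : Set where
  field
    nsym  : ℕ
    arity : Fin nsym → ℕ
open Signature public

-- A finite τ-structure with non-empty domain Fin (suc size);
-- each relation is given by its (decidable) characteristic function.
record Structure (τ : Signature) : Set where
  field
    size : ℕ
    rel  : (R : Fin (nsym τ)) → Vec (Fin (suc size)) (arity τ R) → Bool
open Structure public

Dom : {τ : Signature} → Structure τ → Set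
Dom A = Fin (suc (size A))

Hom : {τ : Signature} → Structure τ → Structure τ → Set
Hom {τ} F D =
  Σ (Dom F → Dom D) λ h →
    (R : Fin (nsym τ)) (t : Vec (Dom F) (arity τ R)) →
    rel F R t ≡ true → rel D R (map h t) ≡ true

-- hom_𝔹(F,D) = b, stated relationally: b is 1 iff a homomorphism exists.
data HomB {τ : Signature} (F D : Structure τ) : Bool → Set where
  hom-yes : Hom F D → HomB F D true
  hom-no  : ¬ Hom F D → HomB F D false

data Atom (τ : Signature) (k : ℕ) (iar : Fin k → ℕ) (v : ℕ) : Set where
  edb : (R : Fin (nsym τ)) → Vec (Fin v) (arity τ R) → Atom τ k iar v
  idb : (p : Fin k) → Vec (Fin v) (iar p) → Atom τ k iar v
  eq  : Fin v → Fin v → Atom τ k iar v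

record Rule (τ : Signature) (k : ℕ) (iar : Fin k → ℕ) : Set where
  field
    nvars : ℕ
    head  : Fin k
    hargs : Vec (Fin nvars) (iar head)
    body  : List (Atom τ k iar nvars)
open Rule public

-- A Boolean Datalog program: intensional predicates (not in τ, kept as a
-- separate sort), a finite list of rules and a 0-ary goal predicate.
record Program (τ : Signature) : Set where
  field
    nidb   : ℕ
    iarity : Fin nidb → ℕ
    rules  : List (Rule τ nidb iarity)
    goal   : Fin nidb
    goal0  : iarity goal ≡ 0
open Program public

-- Least-fixpoint semantics, given as the inductive set of derivable facts.
module _ {τ : Signature} (P : Program τ) (D : Structure τ) where
  mutual
    data Derived : (p : Fin (nidb P)) → Vec (Dom D) (iarity P p) → Set where
      fire : (r : Rule τ (nidb P) (iarity P)) → r ∈ rules P →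
             (a : Fin (nvars r) → Dom D) →
             SatBody r a (body r) →
             Derived (head r) (map a (hargs r))

    data SatBody (r : Rule τ (nidb P) (iarity P)) (a : Fin (nvars r) → Dom D)
         : List (Atom τ (nidb P) (iarity P) (nvars r)) → Set where
      []     : SatBody r a []
      edb∷   : ∀ {R xs bs} → rel D R (map a xs) ≡ true →
               SatBody r a bs → SatBody r a (edb R xs ∷ bs)
      idb∷   : ∀ {q xs bs} → Derived q (map a xs) →
               SatBody r a bs → SatBody r a (idb q xs ∷ bs)
      eq∷    : ∀ {x y bs} → a x ≡ a y →
               SatBody r a bs → SatBody r a (eq x y ∷ bs)

Accepts : {τ : Signature} → Program τ → Structure τ → Set
Accepts P D = Σ (Vec (Dom D) (iarity P (goal P))) λ t → Derived P D (goal P) t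

countIDB : ∀ {τ k iar v} → List (Atom τ k iar v) → ℕ
countIDB []              = zero
countIDB (edb _ _ ∷ bs)  = countIDB bs
countIDB (idb _ _ ∷ bs)  = suc (countIDB bs)
countIDB (eq _ _ ∷ bs)   = countIDB bs

Monadic : {τ : Signature} → Program τ → Set
Monadic P = (p : Fin (nidb P)) → p ≢ goal P → iarity P p ≡ 1

Linear : {τ : Signature} → Program τ → Set
Linear {τ} P = (r : Rule τ (nidb P) (iarity P)) → r ∈ rules P → countIDB (body r) ≤ 1

data Node (τ : Signature) : Set where
  query : Structure τ → Node τ
  YES   : Node τ
  NO    : Node τ

QueryAlg : Signature → Set
QueryAlg τ = List Bool → Node τ

-- Reaches G D σ : σ is one of the σ_i on the computation path of G on D.
data Reaches {τ : Signature} (G : QueryAlg τ) (D : Structure τ) : List Bool → Set where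
  start : Reaches G D []
  step  : ∀ {σ F b} → Reaches G D σ → G σ ≡ query F → HomB F D b →
          Reaches G D (σ ∷ʳ b)

Answer : {τ : Signature} → Node τ → Set
Answer n = (n ≡ YES) ⊎ (n ≡ NO)

Total : {τ : Signature} → QueryAlg τ → Set
Total {τ} G = (D : Structure τ) → Σ (List Bool) λ σ → Reaches G D σ × Answer (G σ)

Decides : {τ : Signature} → QueryAlg τ → (Structure τ → Set) → Set
Decides {τ} G C =
  Total G ×
  ((D : Structure τ) (σ : List Bool) → Reaches G D σ →
     (G σ ≡ YES → C D) × (G σ ≡ NO → ¬ C D))

-- The program accepts a structure iff some T-element is reachable along E-edges from some
-- S-element. It rejects the structure with two looped elements s (in S) and t (in T), and
-- accepts the path 0 → 1 → ⋯ → m with loops at 0 and m, where S = {0} and T = {m}. Both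
-- answer a homomorphism query F alike whenever F has fewer than m elements: the two loops
-- map into the path, and a map from F into the path misses one of the m vertices 1, …, m
-- (pigeonhole), so cutting the path just before the missed vertex folds it onto the loops.
-- The computation of an algorithm on the two loops asks only finitely many queries, so it
-- is also its computation on a long enough path, where it must give the opposite answer.
module Submission where

open import Defs
open import Data.Product using (Σ; _×_)
open import Relation.Nullary using (¬_)

open import Data.Bool using (Bool; true; if_then_else_)
open import Data.Empty using (⊥; ⊥-elim)
open import Data.Fin as Fin using (Fin; zero; suc; toℕ; fromℕ; fromℕ<)
open import Data.Fin.Properties using (toℕ-fromℕ; toℕ-fromℕ<; fromℕ<-toℕ; toℕ<n; toℕ-injective; any?; ¬∀⟶∃¬; <⇒notInjective)
open import Data.List using ([]; _∷_)
open import Data.List.Relation.Unary.Any using (here; there)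
open import Data.Nat as ℕ using (ℕ; _≤_; _<_; _⊔_; s≤s; z≤n; _<?_)
open import Data.Nat.Properties using (≤∧≢⇒<; ≮⇒≥; ≤⇒≯; m≤n⇒m≤1+n; n<1+n; <-trans; ≤-<-trans; m≤m⊔n; m≤n⊔m; suc-injective)
open import Data.Product using (_,_; proj₁; proj₂; ∃)
open import Data.Sum using (_⊎_; inj₁; inj₂)
open import Data.Vec as Vec using (Vec; []; _∷_)
open import Data.Vec.Properties using (map-∘)
open import Function using (_∘_)
open import Function.Bundles using (_⇔_; mk⇔; Equivalence)
open import Function.Definitions using (Injective)
open import Relation.Binary.Definitions using (DecidableEquality)
open import Relation.Binary.PropositionalEquality using (_≡_; _≢_; refl; sym; trans; cong; subst)
open import Relation.Nullary using (Dec; yes; no; does)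
open import Relation.Nullary.Decidable using (dec-true; dec-false; _⊎-dec_; _×-dec_)

true⇒witness : ∀ {A : Set} (a? : Dec A) → does a? ≡ true → A
true⇒witness (yes a) _ = a

<⇒∃-missed : ∀ {k n} {B : Set} → DecidableEquality B → k < n →
             (h : Fin k → B) (f : Fin n → B) → Injective _≡_ _≡_ f →
             ∃ λ i → ∀ x → h x ≢ f i
<⇒∃-missed {k} {n} _≟_ k<n h f f-inj =
  let (i , unhit) = ¬∀⟶∃¬ n Hit (λ i → any? (λ x → h x ≟ f i)) all-hit⇒injection
  in i , λ x hx≡fi → unhit (x , hx≡fi)
  where
  Hit : Fin n → Set
  Hit i = ∃ λ x → h x ≡ f i

  all-hit⇒injection : ¬ (∀ i → Hit i)
  all-hit⇒injection hit = <⇒notInjective k<n preimage-injective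
    where
    preimage-injective : Injective _≡_ _≡_ (proj₁ ∘ hit)
    preimage-injective {i} {j} same-preimage =
      f-inj (trans (sym (proj₂ (hit i))) (trans (cong h same-preimage) (proj₂ (hit j))))

Hom-trans : ∀ {τ} {X Y Z : Structure τ} → Hom X Y → Hom Y Z → Hom X Z
Hom-trans {Z = Z} (f , f-hom) (g , g-hom) = g ∘ f , λ R t Rt →
  subst (λ u → rel Z R u ≡ true) (sym (map-∘ g f t)) (g-hom R (Vec.map f t) (f-hom R t Rt))

HomB-transfer : ∀ {τ} {F D D′ : Structure τ} {b} → Hom F D ⇔ Hom F D′ → HomB F D b → HomB F D′ b
HomB-transfer F→D⇔F→D′ (hom-yes φ) = hom-yes (Equivalence.to F→D⇔F→D′ φ)
HomB-transfer F→D⇔F→D′ (hom-no ¬φ) = hom-no (¬φ ∘ Equivalence.from F→D⇔F→D′)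

AgreeBelow : ∀ {τ} → ℕ → Structure τ → Structure τ → Set
AgreeBelow {τ} n D D′ = (F : Structure τ) → size F < n → Hom F D ⇔ Hom F D′

module _ {τ : Signature} (G : QueryAlg τ) where

  maxQuerySize : ∀ {D σ} → Reaches G D σ → ℕ
  maxQuerySize start                = 0
  maxQuerySize (step {F = F} r _ _) = maxQuerySize r ⊔ size F

  Reaches-transfer : ∀ {D D′ n σ} → AgreeBelow n D D′ →
                     (r : Reaches G D σ) → maxQuerySize r < n → Reaches G D′ σ
  Reaches-transfer agree start _ = start
  Reaches-transfer agree (step {F = F} r asks-F answer) bound =
    step (Reaches-transfer agree r (≤-<-trans (m≤m⊔n _ (size F)) bound)) asks-F
         (HomB-transfer (agree F (≤-<-trans (m≤n⊔m (maxQuerySize r) _) bound)) answer)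

  fooling⇒¬Decides : ∀ {C : Structure τ → Set} (D : Structure τ) (A : ℕ → Structure τ) →
                     (∀ n → AgreeBelow n D (A n)) → ¬ C D → (∀ n → C (A n)) → ¬ Decides G C
  fooling⇒¬Decides D A agree ¬CD CA (total , correct) with total D
  ... | σ , r , inj₁ says-yes = ¬CD (proj₁ (correct D σ r) says-yes)
  ... | σ , r , inj₂ says-no =
    proj₂ (correct (A n) σ (Reaches-transfer (agree n) r (n<1+n _))) says-no (CA n)
    where
    n : ℕ
    n = ℕ.suc (maxQuerySize r)

pattern E = zero
pattern S = suc zero
pattern T = suc (suc zero)

stGraph : Signature
stGraph = record { nsym = 3 ; arity = λ { E → 2 ; S → 1 ; T → 1 } }

pattern Reach = zero
pattern Goal  = suc zero

reachArity : Fin 2 → ℕ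
reachArity Reach = 1
reachArity Goal  = 0

-- Reach(x) ← S(x).    Reach(y) ← Reach(x), E(x, y).    Goal ← Reach(x), T(x).
source-rule step-rule goal-rule : Rule stGraph 2 reachArity
source-rule = record { nvars = 1 ; head = Reach ; hargs = zero ∷ []
                     ; body = edb S (zero ∷ []) ∷ [] }
step-rule   = record { nvars = 2 ; head = Reach ; hargs = suc zero ∷ []
                     ; body = idb Reach (zero ∷ []) ∷ edb E (zero ∷ suc zero ∷ []) ∷ [] }
goal-rule   = record { nvars = 1 ; head = Goal ; hargs = []
                     ; body = idb Reach (zero ∷ []) ∷ edb T (zero ∷ []) ∷ [] }

reachability : Program stGraph
reachability = record { nidb = 2 ; iarity = reachArity
                      ; rules = source-rule ∷ step-rule ∷ goal-rule ∷ []
                      ; goal = Goal ; goal0 = refl }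

reachability-monadic : Monadic reachability
reachability-monadic Reach _    = refl
reachability-monadic Goal  ≢goal = ⊥-elim (≢goal refl)

reachability-linear : Linear reachability
reachability-linear _ (here refl)                 = z≤n
reachability-linear _ (there (here refl))         = s≤s z≤n
reachability-linear _ (there (there (here refl))) = s≤s z≤n

twoLoopsRel : (R : Fin 3) → Vec (Fin 2) (arity stGraph R) → Bool
twoLoopsRel E (x ∷ y ∷ []) = does (x Fin.≟ y)
twoLoopsRel S (x ∷ [])     = does (x Fin.≟ zero)
twoLoopsRel T (x ∷ [])     = does (x Fin.≟ suc zero)

twoLoops : Structure stGraph
twoLoops = record { size = 1 ; rel = twoLoopsRel }

module _ (m : ℕ) where

  PathEdge : Fin (ℕ.suc m) → Fin (ℕ.suc m) → Set
  PathEdge x y = ℕ.suc (toℕ x) ≡ toℕ y ⊎ (x ≡ y × (toℕ x ≡ 0 ⊎ toℕ x ≡ m))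

  pathEdge? : ∀ x y → Dec (PathEdge x y)
  pathEdge? x y =
    (ℕ.suc (toℕ x) ℕ.≟ toℕ y) ⊎-dec ((x Fin.≟ y) ×-dec ((toℕ x ℕ.≟ 0) ⊎-dec (toℕ x ℕ.≟ m)))

  pathRel : (R : Fin 3) → Vec (Fin (ℕ.suc m)) (arity stGraph R) → Bool
  pathRel E (x ∷ y ∷ []) = does (pathEdge? x y)
  pathRel S (x ∷ [])     = does (toℕ x ℕ.≟ 0)
  pathRel T (x ∷ [])     = does (toℕ x ℕ.≟ m)

  Path : Structure stGraph
  Path = record { size = m ; rel = pathRel }

SourceFact : (p : Fin 2) → Vec (Fin 2) (reachArity p) → Set
SourceFact Reach (v ∷ []) = v ≡ zero
SourceFact Goal  []       = ⊥

twoLoops-derived⇒SourceFact : ∀ {p t} → Derived reachability twoLoops p t → SourceFact p t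
twoLoops-derived⇒SourceFact (fire _ (here refl) a (edb∷ S[a₀] [])) =
  true⇒witness (a zero Fin.≟ zero) S[a₀]
twoLoops-derived⇒SourceFact (fire _ (there (here refl)) a (idb∷ reach[a₀] (edb∷ E[a₀,a₁] []))) =
  trans (sym (true⇒witness (a zero Fin.≟ a (suc zero)) E[a₀,a₁]))
        (twoLoops-derived⇒SourceFact reach[a₀])
twoLoops-derived⇒SourceFact (fire _ (there (there (here refl))) a (idb∷ reach[a₀] (edb∷ T[a₀] [])))
  with () ← trans (sym (twoLoops-derived⇒SourceFact reach[a₀]))
                  (true⇒witness (a zero Fin.≟ suc zero) T[a₀])

twoLoops-rejected : ¬ Accepts reachability twoLoops
twoLoops-rejected ([] , goal) = twoLoops-derived⇒SourceFact goal

path-reach : ∀ m (v : Fin (ℕ.suc m)) → Derived reachability (Path m) Reach (v ∷ [])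
path-reach m v =
  subst (λ w → Derived reachability (Path m) Reach (w ∷ [])) (fromℕ<-toℕ v (toℕ<n v))
        (reach-fromℕ< (toℕ v) (toℕ<n v))
  where
  reach-fromℕ< : ∀ k (k<1+m : k < ℕ.suc m) →
                 Derived reachability (Path m) Reach (fromℕ< k<1+m ∷ [])
  reach-fromℕ< ℕ.zero    k<1+m = fire source-rule (here refl) (λ _ → fromℕ< k<1+m) (edb∷ refl [])
  reach-fromℕ< (ℕ.suc k) k+1<1+m =
    fire step-rule (there (here refl)) (Vec.lookup (fromℕ< k<1+m ∷ fromℕ< k+1<1+m ∷ []))
      (idb∷ (reach-fromℕ< k k<1+m) (edb∷ (dec-true (pathEdge? m _ _) (inj₁ successor)) []))
    where
    k<1+m : k < ℕ.suc m
    k<1+m = <-trans (n<1+n k) k+1<1+m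
    successor : ℕ.suc (toℕ (fromℕ< k<1+m)) ≡ toℕ (fromℕ< k+1<1+m)
    successor = trans (cong ℕ.suc (toℕ-fromℕ< k<1+m)) (sym (toℕ-fromℕ< k+1<1+m))

path-accepted : ∀ m → Accepts reachability (Path m)
path-accepted m = [] , fire goal-rule (there (there (here refl))) (λ _ → fromℕ m)
  (idb∷ (path-reach m (fromℕ m)) (edb∷ (dec-true (toℕ (fromℕ m) ℕ.≟ m) (toℕ-fromℕ m)) []))

twoLoops→Path : ∀ m → Hom twoLoops (Path m)
twoLoops→Path m = ends , preserves
  where
  ends : Fin 2 → Fin (ℕ.suc m)
  ends zero       = zero
  ends (suc zero) = fromℕ m

  ends-are-ends : ∀ x → toℕ (ends x) ≡ 0 ⊎ toℕ (ends x) ≡ m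
  ends-are-ends zero       = inj₁ refl
  ends-are-ends (suc zero) = inj₂ (toℕ-fromℕ m)

  preserves : ∀ R t → twoLoopsRel R t ≡ true → pathRel m R (Vec.map ends t) ≡ true
  preserves E (x ∷ y ∷ []) E[x,y] with refl ← true⇒witness (x Fin.≟ y) E[x,y] =
    dec-true (pathEdge? m (ends x) (ends x)) (inj₂ (refl , ends-are-ends x))
  preserves S (zero ∷ [])     _ = refl
  preserves T (suc zero ∷ []) _ = dec-true (toℕ (fromℕ m) ℕ.≟ m) (toℕ-fromℕ m)

side : ℕ → ℕ → Fin 2
side c v = if does (v <? c) then zero else suc zero

side-< : ∀ {c v} → v < c → side c v ≡ zero
side-< {c} {v} v<c rewrite dec-true (v <? c) v<c = refl

side-≥ : ∀ {c v} → c ≤ v → side c v ≡ suc zero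
side-≥ {c} {v} c≤v rewrite dec-false (v <? c) (≤⇒≯ c≤v) = refl

side-suc : ∀ {c u} → ℕ.suc u ≢ c → side c u ≡ side c (ℕ.suc u)
side-suc {c} {u} 1+u≢c with u <? c
... | yes u<c = trans (side-< u<c) (sym (side-< (≤∧≢⇒< u<c 1+u≢c)))
... | no  u≮c = trans (side-≥ (≮⇒≥ u≮c)) (sym (side-≥ (m≤n⇒m≤1+n (≮⇒≥ u≮c))))

side-edge : ∀ {m c u v} → PathEdge m u v → toℕ v ≢ c → side c (toℕ u) ≡ side c (toℕ v)
side-edge {c = c} (inj₁ 1+u≡v) v≢c =
  trans (side-suc (v≢c ∘ trans (sym 1+u≡v))) (cong (side c) 1+u≡v)
side-edge (inj₂ (refl , _)) _ = refl

cut : ∀ {m c} {F : Structure stGraph} → 1 ≤ c → c ≤ m →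
      (φ : Hom F (Path m)) → (∀ x → toℕ (proj₁ φ x) ≢ c) → Hom F twoLoops
cut {m} {c} {F} 1≤c c≤m (h , h-hom) avoids-c = side c ∘ toℕ ∘ h , preserves
  where
  preserves : ∀ R t → rel F R t ≡ true → twoLoopsRel R (Vec.map (side c ∘ toℕ ∘ h) t) ≡ true
  preserves E (x ∷ y ∷ []) E[x,y] =
    dec-true (_ Fin.≟ _) (side-edge (true⇒witness (pathEdge? m (h x) (h y)) (h-hom E _ E[x,y]))
                                    (avoids-c y))
  preserves S (x ∷ []) S[x] with toℕ (h x) | true⇒witness (toℕ (h x) ℕ.≟ 0) (h-hom S _ S[x])
  ... | _ | refl = dec-true (_ Fin.≟ zero) (side-< 1≤c)
  preserves T (x ∷ []) T[x] with toℕ (h x) | true⇒witness (toℕ (h x) ℕ.≟ m) (h-hom T _ T[x])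
  ... | _ | refl = dec-true (_ Fin.≟ suc zero) (side-≥ c≤m)

small-Hom-Path⇒Hom-twoLoops : ∀ {m} {F : Structure stGraph} → ℕ.suc (size F) < m →
                              Hom F (Path m) → Hom F twoLoops
small-Hom-Path⇒Hom-twoLoops {m} |F|<m φ =
  let (i , missed) = <⇒∃-missed ℕ._≟_ |F|<m (toℕ ∘ proj₁ φ) (ℕ.suc ∘ toℕ) inner-injective
  in cut (s≤s z≤n) (toℕ<n i) φ missed
  where
  inner-injective : Injective _≡_ _≡_ (ℕ.suc ∘ toℕ {m})
  inner-injective = toℕ-injective ∘ suc-injective

twoLoops-agree-with-Path : ∀ n → AgreeBelow n twoLoops (Path (ℕ.suc n))
twoLoops-agree-with-Path n F |F|<n =
  mk⇔ (λ φ → Hom-trans {Z = Path (ℕ.suc n)} φ (twoLoops→Path _))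
      (small-Hom-Path⇒Hom-twoLoops (s≤s |F|<n))

theorem27 : Σ Signature λ τ → Σ (Program τ) λ P →
                Monadic P × Linear P ×
                ((G : QueryAlg τ) → ¬ Decides G (Accepts P))
theorem27 =
  stGraph , reachability , reachability-monadic , reachability-linear , λ G →
    fooling⇒¬Decides G twoLoops (Path ∘ ℕ.suc)
      twoLoops-agree-with-Path twoLoops-rejected (path-accepted ∘ ℕ.suc)
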